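{- Let $p$ be an odd prime and $\lambda$ a self-conjugate partition. If $a^*_\lambda$ is even, then $p\mid a^*_\lambda$.
   Context: A partition is a weakly decreasing sequence $\lambda=(\lambda_1\geq\lambda_2\geq\cdots)$ of nonnegative integers with finitely many nonzero terms; $\ell(\lambda)$ is the number of nonzero parts; $[\lambda]=\{(i,j):i\geq1,\ 1\leq j\leq\lambda_i\}$ (rows downward); self-conjugate means $[\lambda]$ is symmetric under $(i,j)\mapsto(j,i)$. $p$-rim: the rim is the set of $(i,j)\in[\lambda]$ with $(i+1,j+1)\notin[\lambda]$. Label rim nodes $1,2,\dots$ along the rim from $(1,\lambda_1)$ towards the bottom-left. The first $p$-segment is the rim nodes with labels $\leq p$. If the last node of a $p$-segment is in row $i<\ell(\lambda)$ and $l$ is the smallest label of a rim node in row $i+1$, the next $p$-segment is the rim nodes with labels $l,\dots,l+p-1$ (those which exist); continue until the last row. $\mathrm{Rim}_p(\lambda)$ is the union of the $p$-segments. For self-conjugate $\lambda$: $U_\lambda=\{(i,j)\in\mathrm{Rim}_p(\lambda):i\leq j\}$, $L_\lambda=\{(j,i):(i,j)\in U_\lambda\}$, $a^*_\lambda=\#(U_\lambda\cup L_\lambda)$. -}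

module Defs where

open import Data.Nat using (ℕ; zero; suc; _≤_; _<_; _≤ᵇ_; _<ᵇ_; _≡ᵇ_)
open import Data.Bool using (Bool; true; false; _∧_; not; if_then_else_)
open import Data.List using (List; []; _∷_; length; map; concatMap; filterᵇ; take; dropWhileᵇ; last; _++_; deduplicateᵇ)
open import Data.List.Relation.Unary.All using (All)
open import Data.List.Relation.Unary.Linked using (Linked)
open import Data.Maybe using (Maybe; just; nothing)
open import Data.Product using (_×_; _,_; proj₁; proj₂)

-- A partition is represented by the list of its nonzero parts (λ₁, …, λ_ℓ):
-- all parts positive and weakly decreasing.
IsPartition : List ℕ → Set
IsPartition λ′ = All (λ x → 1 ≤ x) λ′ × Linked (λ a b → b ≤ a) λ′

len : List ℕ → ℕ
len = length

-- part λ i = λ_i (1-indexed); 0 for i = 0 or i > ℓ(λ)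
part : List ℕ → ℕ → ℕ
part []       _             = 0
part (x ∷ xs) zero          = 0
part (x ∷ xs) (suc zero)    = x
part (x ∷ xs) (suc (suc i)) = part xs (suc i)

_∈D_ : ℕ × ℕ → List ℕ → Set
(i , j) ∈D λ′ = 1 ≤ i × 1 ≤ j × j ≤ part λ′ i

inDiagᵇ : List ℕ → ℕ → ℕ → Bool
inDiagᵇ λ′ i j = (1 ≤ᵇ i) ∧ ((1 ≤ᵇ j) ∧ (j ≤ᵇ part λ′ i))

SelfConjugate : List ℕ → Set
SelfConjugate λ′ = ∀ i j → ((i , j) ∈D λ′ → (j , i) ∈D λ′) × ((j , i) ∈D λ′ → (i , j) ∈D λ′)

desc : ℕ → List ℕ
desc zero    = []
desc (suc n) = suc n ∷ desc n

asc : ℕ → List ℕ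
asc zero    = []
asc (suc n) = asc n ++ (suc n ∷ [])

Node : Set
Node = ℕ × ℕ

-- rim nodes of row i, in the order along the rim (right to left):
-- (i , j) ∈ [λ] with (i+1 , j+1) ∉ [λ]
rimRow : List ℕ → ℕ → List Node
rimRow λ′ i = map (λ j → (i , j)) (filterᵇ (λ j → not (inDiagᵇ λ′ (suc i) (suc j))) (desc (part λ′ i)))

-- the rim, listed along the rim from (1 , λ₁) towards the bottom-left;
-- the label of a node is its (1-based) position in this list
rim : List ℕ → List Node
rim λ′ = concatMap (rimRow λ′) (asc (len λ′))

-- Given the rim nodes with labels ≥ s (as the suffix `rs` of the rim),
-- produce the p-segment starting at label s and all subsequent p-segments.
-- The next segment starts at the first rim node in row i+1, where i is the
-- row of the last node of the current segment; stop when i = ℓ(λ).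
-- (fuel: the row strictly increases at each step, so ℓ(λ) steps suffice)
pSegs : ℕ → ℕ → ℕ → List Node → List Node
pSegs zero     p ℓ rs = []
pSegs (suc fu) p ℓ rs with take p rs
... | seg with last seg
...   | nothing      = seg
...   | just (i , _) = seg ++ (if i <ᵇ ℓ
                               then pSegs fu p ℓ (dropWhileᵇ (λ n → proj₁ n ≤ᵇ i) rs)
                               else [])

pRim : ℕ → List ℕ → List Node
pRim p λ′ = pSegs (suc (len λ′)) p (len λ′) (rim λ′)

U : ℕ → List ℕ → List Node
U p λ′ = filterᵇ (λ n → proj₁ n ≤ᵇ proj₂ n) (pRim p λ′)

L : ℕ → List ℕ → List Node
L p λ′ = map (λ n → (proj₂ n , proj₁ n)) (U p λ′)

_≡Nᵇ_ : Node → Node → Bool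
(a , b) ≡Nᵇ (c , d) = (a ≡ᵇ c) ∧ (b ≡ᵇ d)

aStar : ℕ → List ℕ → ℕ
aStar p λ′ = length (deduplicateᵇ _≡Nᵇ_ (U p λ′ ++ L p λ′))

module Submission where

-- Content c(i , j) = j - i strictly decreases (by exactly one per step) along the
-- rim, which is a lattice path moving left or down and ending at (ℓ , 1), weakly below the
-- diagonal.  Rim_p is a sublist of the rim, made of p-segments each of which is the first p nodes
-- of a final piece of the rim.
--
--  * If Rim_p contains no diagonal node, each segment lies entirely on one side of the diagonal
--    (a step changes the content by one, so crossing requires content 0).  A segment above the
--    diagonal cannot reach the end (ℓ , 1) of the rim, so it has exactly p nodes.  Hence
--    p ∣ |U_λ|; moreover U_λ and its mirror image L_λ are disjoint lists without repetitions, so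
--    a*_λ = 2 |U_λ| and p ∣ a*_λ.
--  * If Rim_p contains a diagonal node d, content order forces U_λ = U′ ++ [ d ] with U′ strictly
--    above the diagonal, and L_λ = mirror(U′) ++ [ d ]; thus a*_λ = 2 |U′| + 1 is odd.

open import Defs
open import Data.Nat using (ℕ; zero; suc; _+_; _≤_; _<_; _⊔_; _<ᵇ_; _≤ᵇ_; z≤n; s≤s)
open import Data.Nat.Properties
open import Data.Nat.Divisibility using (_∣_; divides; _∣0; ∣-refl; ∣m∣n⇒∣m+n; ∣m+n∣m⇒∣n; ∣1⇒≡1)
open import Data.Nat.Primality using (Prime)
open import Data.Integer as ℤ using (ℤ; _⊖_)
import Data.Integer.Properties as ℤ
open import Data.Bool using (true; false; not; T; if_then_else_)
open import Data.Bool.Properties using (T-≡; T-not-≡; T-∧; ¬-not)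
open import Data.List using (List; []; _∷_; [_]; _++_; map; concatMap; length; take; drop; last;
  filter; dropWhile; dropWhileᵇ; deduplicate; deduplicateᵇ)
open import Data.List.Properties using (filter-all; filter-none; filter-accept; filter-reject; filter-++;
  filter-≐; ++-identityʳ; ++-assoc; concatMap-++; length-++; length-map; map-++; length-take; take-all;
  take++drop≡id)
open import Data.List.Membership.Propositional using (_∈_; find)
open import Data.List.Membership.Propositional.Properties using (∈-++⁺ˡ; ∈-++⁺ʳ; ∈-filter⁺)
open import Data.List.Relation.Unary.All as All using (All; []; _∷_)
import Data.List.Relation.Unary.All.Properties as All
open import Data.List.Relation.Unary.Any using (Any; here; there; any?)
open import Data.List.Relation.Unary.AllPairs as AllPairs using (AllPairs; []; _∷_)
import Data.List.Relation.Unary.AllPairs.Properties as AllPairs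
open import Data.List.Relation.Unary.Linked as Linked using (Linked; []; [-]; _∷_)
open import Data.List.Relation.Unary.Linked.Properties using (Linked⇒AllPairs)
open import Data.List.Relation.Unary.Unique.Propositional using (Unique)
import Data.List.Relation.Unary.Unique.Propositional.Properties as Unique
open import Data.List.Relation.Binary.Sublist.Propositional using (_⊆_; []; _∷_; _∷ʳ_; minimum; ⊆-refl; ⊆-trans)
open import Data.List.Relation.Binary.Sublist.Propositional.Properties
  using (All-resp-⊆; take-⊆; dropWhile-⊆; filter-⊆; ++⁺; ++⁺ʳ)
open import Data.List.Relation.Binary.Disjoint.Propositional using (Disjoint)
open import Data.Maybe using (just; nothing)
open import Data.Maybe.Relation.Unary.All as MaybeAll using (just; nothing)
open import Data.Product using (_×_; _,_; proj₁; proj₂; ∃; swap; uncurry)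
open import Data.Product.Properties using (≡-dec)
open import Data.Sum using (_⊎_; inj₁; inj₂)
open import Data.Empty using (⊥; ⊥-elim)
open import Function using (_∘_; _⇔_; Equivalence; mk⇔)
open import Level using (0ℓ)
open import Relation.Binary using (Rel; DecidableEquality) renaming (Decidable to Decidable₂)
open import Relation.Binary.PropositionalEquality
  using (_≡_; _≢_; refl; sym; trans; cong; cong₂; subst; subst₂; module ≡-Reasoning)
open import Relation.Nullary using (¬_; yes; no; does; ¬?; contradiction)
open import Relation.Nullary.Decidable using (T?)
open import Relation.Unary using (Pred; Decidable; _≐_)

private variable
  A : Set

Linked-take : {R : Rel A 0ℓ} (n : ℕ) {xs : List A} → Linked R xs → Linked R (take n xs)
Linked-take zero          _       = []
Linked-take (suc n)       []      = []
Linked-take (suc zero)    [-]     = [-]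
Linked-take (suc (suc n)) [-]     = [-]
Linked-take (suc zero)    (r ∷ l) = [-]
Linked-take (suc (suc n)) (r ∷ l) = r ∷ Linked-take (suc n) l

Linked-dropWhile : {R : Rel A 0ℓ} {P : Pred A 0ℓ} (P? : Decidable P) {xs : List A} →
  Linked R xs → Linked R (dropWhile P? xs)
Linked-dropWhile P? [] = []
Linked-dropWhile P? {x ∷ []} [-] with does (P? x)
... | true  = []
... | false = [-]
Linked-dropWhile P? {x ∷ _ ∷ _} (r ∷ l) with does (P? x)
... | true  = Linked-dropWhile P? l
... | false = r ∷ l

last-dropWhile : {P Q : Pred A 0ℓ} (Q? : Decidable Q) (xs : List A) →
  MaybeAll.All P (last xs) → MaybeAll.All P (last (dropWhile Q? xs))
last-dropWhile Q? [] h = h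
last-dropWhile {P = P} Q? (x ∷ xs) h with does (Q? x)
... | false = h
... | true  = last-dropWhile Q? xs (last-tail xs h)
  where
  last-tail : (ys : List _) → MaybeAll.All P (last (x ∷ ys)) → MaybeAll.All P (last ys)
  last-tail []      _ = nothing
  last-tail (_ ∷ _) h = h

dropWhile-take : {P : Pred A 0ℓ} (P? : Decidable P) (n : ℕ) (xs : List A) →
  All P (take n xs) → dropWhile P? xs ≡ dropWhile P? (drop n xs)
dropWhile-take P? zero    xs       _          = refl
dropWhile-take P? (suc n) []       _          = refl
dropWhile-take P? (suc n) (x ∷ xs) (px ∷ pxs) with P? x
... | yes _  = dropWhile-take P? n xs pxs
... | no ¬px = ⊥-elim (¬px px)

AllPairs-⊆ : {R : Rel A 0ℓ} {xs ys : List A} → xs ⊆ ys → AllPairs R ys → AllPairs R xs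
AllPairs-⊆ []         []       = []
AllPairs-⊆ (_ ∷ʳ s)   (_ ∷ rs) = AllPairs-⊆ s rs
AllPairs-⊆ (refl ∷ s) (r ∷ rs) = All-resp-⊆ s r ∷ AllPairs-⊆ s rs

AllPairs-last : {R : Rel A 0ℓ} {xs : List A} {y : A} → AllPairs R (xs ++ [ y ]) → All (λ x → R x y) xs
AllPairs-last {xs = []}     _        = []
AllPairs-last {xs = x ∷ xs} (r ∷ rs) = All.head (All.++⁻ʳ xs r) ∷ AllPairs-last rs

deduplicate-≐ : {R S : Rel A 0ℓ} (R? : Decidable₂ R) (S? : Decidable₂ S) →
  (∀ {x y} → R x y ⇔ S x y) → (xs : List A) → deduplicate R? xs ≡ deduplicate S? xs
deduplicate-≐ R? S? R⇔S [] = refl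
deduplicate-≐ {R = R} {S} R? S? R⇔S (x ∷ xs) = cong (x ∷_) (begin
  filter (¬? ∘ R? x) (deduplicate R? xs) ≡⟨ filter-≐ (¬? ∘ R? x) (¬? ∘ S? x) ¬R≐¬S (deduplicate R? xs) ⟩
  filter (¬? ∘ S? x) (deduplicate R? xs) ≡⟨ cong (filter (¬? ∘ S? x)) (deduplicate-≐ R? S? R⇔S xs) ⟩
  filter (¬? ∘ S? x) (deduplicate S? xs) ∎)
  where
  open ≡-Reasoning
  ¬R≐¬S : (λ y → ¬ R x y) ≐ (λ y → ¬ S x y)
  ¬R≐¬S = (λ ¬r s → ¬r (Equivalence.from R⇔S s)) , (λ ¬s r → ¬s (Equivalence.to R⇔S r))

module _ {A : Set} (eq? : DecidableEquality A) where
  open ≡-Reasoning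

  deduplicate-unique : {xs : List A} → Unique xs → deduplicate eq? xs ≡ xs
  deduplicate-unique [] = refl
  deduplicate-unique {x ∷ xs} (x∉xs ∷ u) = cong (x ∷_) (begin
    filter (¬? ∘ eq? x) (deduplicate eq? xs) ≡⟨ cong (filter (¬? ∘ eq? x)) (deduplicate-unique u) ⟩
    filter (¬? ∘ eq? x) xs                   ≡⟨ filter-all (¬? ∘ eq? x) x∉xs ⟩
    xs                                       ∎)

  deduplicate-++-∈ : {xs : List A} {y : A} → Unique xs → y ∈ xs → deduplicate eq? (xs ++ [ y ]) ≡ xs
  deduplicate-++-∈ {x ∷ xs} (x∉xs ∷ u) (here refl) = cong (x ∷_) (begin
    filter (¬? ∘ eq? x) (deduplicate eq? (xs ++ [ x ]))
      ≡⟨ cong (filter (¬? ∘ eq? x)) (deduplicate-unique xs++x-unique) ⟩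
    filter (¬? ∘ eq? x) (xs ++ [ x ])
      ≡⟨ filter-++ (¬? ∘ eq? x) xs [ x ] ⟩
    filter (¬? ∘ eq? x) xs ++ filter (¬? ∘ eq? x) [ x ]
      ≡⟨ cong₂ _++_ (filter-all (¬? ∘ eq? x) x∉xs) (filter-reject (¬? ∘ eq? x) (λ x≢x → x≢x refl)) ⟩
    xs ++ []
      ≡⟨ ++-identityʳ xs ⟩
    xs ∎)
    where
    xs++x-unique : Unique (xs ++ [ x ])
    xs++x-unique = AllPairs.++⁺ u ([] ∷ []) (All.map (λ x≢z → (λ z≡x → x≢z (sym z≡x)) ∷ []) x∉xs)
  deduplicate-++-∈ {x ∷ xs} {y} (x∉xs ∷ u) (there y∈xs) = cong (x ∷_) (begin
    filter (¬? ∘ eq? x) (deduplicate eq? (xs ++ [ y ])) ≡⟨ cong (filter (¬? ∘ eq? x)) (deduplicate-++-∈ u y∈xs) ⟩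
    filter (¬? ∘ eq? x) xs                             ≡⟨ filter-all (¬? ∘ eq? x) x∉xs ⟩
    xs                                                 ∎)

disjoint : {P Q : Pred A 0ℓ} {xs ys : List A} → All P xs → All Q ys → (∀ {v} → P v → Q v → ⊥) →
  Disjoint xs ys
disjoint ps qs incompatible (v∈xs , v∈ys) = incompatible (All.lookup ps v∈xs) (All.lookup qs v∈ys)

-- Geometry of nodes

Above Below StrictlyAbove StrictlyBelow Diagonal : Node → Set
Above         (i , j) = i ≤ j
Below         (i , j) = j ≤ i
StrictlyAbove (i , j) = i < j
StrictlyBelow (i , j) = j < i
Diagonal      (i , j) = i ≡ j

above? : Decidable Above
above? (i , j) = i ≤? j

diagonal? : Decidable Diagonal
diagonal? (i , j) = i ≟ j

content : Node → ℤ
content (i , j) = j ⊖ i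

diagonal-content : ∀ {a} → Diagonal a → content a ≡ ℤ.0ℤ
diagonal-content {i , _} refl = ℤ.n⊖n≡0 i

above-content : ∀ {a} → Above a → ℤ.0ℤ ℤ.≤ content a
above-content {i , j} i≤j = subst (ℤ.0ℤ ℤ.≤_) (sym (ℤ.≤-⊖ i≤j)) (ℤ.+≤+ z≤n)

data Step : Node → Node → Set where
  left : ∀ {i j} → Step (i , suc j) (i , j)
  down : ∀ {i j} → Step (i , j) (suc i , j)

step-content : ∀ {a b} → Step a b → content b ℤ.< content a
step-content {i , suc j} left = ℤ.⊖-monoˡ-< i (n<1+n j)
step-content {i , j}     down = ℤ.⊖-monoʳ->-< j (n<1+n i)

-- a ▷ b : b has strictly smaller content than a, i.e. b comes later along the rim.
_▷_ : Node → Node → Set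
a ▷ b = content b ℤ.< content a

▷-trans : ∀ {a b c} → a ▷ b → b ▷ c → a ▷ c
▷-trans a▷b b▷c = ℤ.<-trans b▷c a▷b

▷⇒≢ : ∀ {a b} → a ▷ b → a ≢ b
▷⇒≢ a▷b refl = ℤ.<-irrefl refl a▷b

chain-ordered : {xs : List Node} → Linked Step xs → AllPairs _▷_ xs
chain-ordered chain = Linked⇒AllPairs (λ {a b c} → ▷-trans {a} {b} {c}) (Linked.map step-content chain)

step-row : ∀ {a b} → Step a b → proj₁ a ≤ proj₁ b
step-row left = ≤-refl
step-row down = n≤1+n _

rows-≤-last : {xs : List Node} {y : Node} → Linked Step xs → last xs ≡ just y →
  All (λ x → proj₁ x ≤ proj₁ y) xs
rows-≤-last [-] refl = ≤-refl ∷ []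
rows-≤-last (s ∷ chain) e with rows-≤-last chain e
... | h ∷ hs = ≤-trans (step-row s) h ∷ h ∷ hs

step-above⁻ : ∀ {a b} → Step a b → Above b → Above a
step-above⁻ left i≤j   = m≤n⇒m≤1+n i≤j
step-above⁻ down 1+i≤j = <⇒≤ 1+i≤j

step-above⁺ : ∀ {a b} → Step a b → ¬ Diagonal a → Above a → Above b
step-above⁺ left off i≤1+j = m<1+n⇒m≤n (≤∧≢⇒< i≤1+j off)
step-above⁺ down off i≤j   = ≤∧≢⇒< i≤j off

sign-constant : {xs : List Node} → Linked Step xs → All (¬_ ∘ Diagonal) xs →
  All Above xs ⊎ All (¬_ ∘ Above) xs
sign-constant [] [] = inj₁ []
sign-constant {x ∷ []} [-] _ with above? x
... | yes above = inj₁ (above ∷ [])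
... | no ¬above = inj₂ (¬above ∷ [])
sign-constant (s ∷ chain) (off ∷ offs) with sign-constant chain offs
... | inj₁ (above ∷ aboves)   = inj₁ (step-above⁻ s above ∷ above ∷ aboves)
... | inj₂ (¬above ∷ ¬aboves) = inj₂ ((λ above′ → ¬above (step-above⁺ s off above′)) ∷ ¬above ∷ ¬aboves)

EndsBelow : List Node → Set
EndsBelow xs = MaybeAll.All Below (last xs)

strictly-above-empty : {xs : List Node} → EndsBelow xs → All Above xs → All (¬_ ∘ Diagonal) xs → xs ≡ []
strictly-above-empty {[]}         _            _            _          = refl
strictly-above-empty {x ∷ []}     (just below) (above ∷ []) (off ∷ []) = ⊥-elim (off (≤-antisym above below))
strictly-above-empty {x ∷ y ∷ ys} end (_ ∷ aboves) (_ ∷ offs) with strictly-above-empty {y ∷ ys} end aboves offs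
... | ()

-- In a list of decreasing content lying weakly above the diagonal, a diagonal node (content 0)
-- can only come last, since all later nodes have negative content.
diagonal-last : ∀ {xs d} → AllPairs _▷_ xs → All Above xs → d ∈ xs → Diagonal d → ∃ λ ys → xs ≡ ys ++ [ d ]
diagonal-last {_ ∷ []}    _ _ (here refl) _ = [] , refl
diagonal-last {_ ∷ y ∷ _} ((d▷y ∷ _) ∷ _) (_ ∷ y-above ∷ _) (here refl) diag =
  ⊥-elim (ℤ.<⇒≱ (subst (content y ℤ.<_) (diagonal-content diag) d▷y) (above-content y-above))
diagonal-last {x ∷ _} (_ ∷ ordered) (_ ∷ above) (there d∈xs) diag with diagonal-last ordered above d∈xs diag
... | ys , xs≡ = x ∷ ys , cong (x ∷_) xs≡

before-diagonal : ∀ {x d} → Above x → x ▷ d → Diagonal d → StrictlyAbove x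
before-diagonal above x▷d diag =
  ≤∧≢⇒< above (λ x-diag → ℤ.<-irrefl (trans (diagonal-content diag) (sym (diagonal-content x-diag))) x▷d)

-- The rim of a partition is a path

data Path : Node → Node → List Node → Set where
  end : ∀ {s} → Path s s [ s ]
  _◅_ : ∀ {s u t xs} → Step s u → Path u t xs → Path s t (s ∷ xs)

infixr 5 _◅_

path-chain : ∀ {s t xs} → Path s t xs → Linked Step xs
path-chain end              = [-]
path-chain (st ◅ end)       = st ∷ [-]
path-chain (st ◅ p@(_ ◅ _)) = st ∷ path-chain p

path-last : ∀ {s t xs} → Path s t xs → last xs ≡ just t
path-last end             = refl
path-last (_ ◅ end)       = refl
path-last (_ ◅ p@(_ ◅ _)) = path-last p

path-++ : ∀ {s t u v xs ys} → Path s t xs → Step t u → Path u v ys → Path s v (xs ++ ys)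
path-++ end     st q = st ◅ q
path-++ (r ◅ p) st q = r ◅ path-++ p st q

desc-≤ : ∀ a → All (_≤ a) (desc a)
desc-≤ zero    = []
desc-≤ (suc a) = ≤-refl ∷ All.map m≤n⇒m≤1+n (desc-≤ a)

row-path : (k : ℕ) {a b : ℕ} → b ≤ a → 1 ≤ a →
  Path (k , a) (k , b ⊔ 1) (map (k ,_) (filter (b ≤?_) (desc a)))
row-path k {suc a} {b} b≤1+a _ =
  subst (Path (k , suc a) (k , b ⊔ 1)) (cong (map (k ,_)) (sym (filter-accept (b ≤?_) b≤1+a))) (run a b≤1+a)
  where
  run : (a : ℕ) {b : ℕ} → b ≤ suc a →
    Path (k , suc a) (k , b ⊔ 1) ((k , suc a) ∷ map (k ,_) (filter (b ≤?_) (desc a)))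
  run zero    z≤n       = end
  run zero    (s≤s z≤n) = end
  run (suc a) {b} b≤2+a with b ≤? suc a
  ... | yes b≤1+a = left ◅ subst (Path (k , suc a) (k , b ⊔ 1) ∘ map (k ,_))
                                  (sym (filter-accept (b ≤?_) b≤1+a)) (run a b≤1+a)
  ... | no b≰1+a with ≤-antisym b≤2+a (≰⇒> b≰1+a)
  ...   | refl = subst (λ xs → Path (k , suc (suc a)) (k , suc (suc a)) ((k , suc (suc a)) ∷ map (k ,_) xs))
                       (sym (filter-none (suc (suc a) ≤?_) (All.map (λ j≤1+a → <⇒≱ (s≤s j≤1+a)) (desc-≤ (suc a)))))
                       end

part-positive : {λ′ : List ℕ} → All (λ x → 1 ≤ x) λ′ → ∀ k → suc k ≤ len λ′ → 1 ≤ part λ′ (suc k)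
part-positive (1≤x ∷ _)  zero    _         = 1≤x
part-positive (_ ∷ pos) (suc k) (s≤s k<ℓ) = part-positive pos k k<ℓ

part-decreasing : {λ′ : List ℕ} → Linked (λ a b → b ≤ a) λ′ → ∀ k → part λ′ (suc (suc k)) ≤ part λ′ (suc k)
part-decreasing []        _       = z≤n
part-decreasing [-]       _       = z≤n
part-decreasing (y≤x ∷ _) zero    = y≤x
part-decreasing (_ ∷ dec) (suc k) = part-decreasing dec k

part-beyond : (λ′ : List ℕ) → part λ′ (suc (len λ′)) ≡ 0
part-beyond []       = refl
part-beyond (_ ∷ λ′) = part-beyond λ′

-- The test in rimRow, (k + 1 , j + 1) ∉ [λ], computes to not (j <ᵇ λ_{k+1}), i.e. λ_{k+1} ≤ j.
≤⇔not-<ᵇ : ∀ b j → b ≤ j ⇔ T (not (j <ᵇ b))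
≤⇔not-<ᵇ b j = mk⇔
  (λ b≤j → Equivalence.from T-not-≡ (¬-not (λ j<ᵇb → <⇒≱ (<ᵇ⇒< j b (Equivalence.from T-≡ j<ᵇb)) b≤j)))
  (λ t → ≮⇒≥ (λ j<b → subst T (Equivalence.to T-not-≡ t) (<⇒<ᵇ j<b)))

rimRow-path : {λ′ : List ℕ} → IsPartition λ′ → ∀ k → suc k ≤ len λ′ →
  Path (suc k , part λ′ (suc k)) (suc k , part λ′ (suc (suc k)) ⊔ 1) (rimRow λ′ (suc k))
rimRow-path {λ′} (pos , dec) k k<ℓ =
  subst (Path (suc k , part λ′ (suc k)) (suc k , b ⊔ 1) ∘ map (suc k ,_))
        (filter-≐ (b ≤?_) (T? ∘ (λ j → not (j <ᵇ b))) ≤≐not-<ᵇ (desc (part λ′ (suc k))))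
    (row-path (suc k) (part-decreasing dec k) (part-positive pos k k<ℓ))
  where
  b = part λ′ (suc (suc k))
  ≤≐not-<ᵇ : (b ≤_) ≐ (λ j → T (not (j <ᵇ b)))
  ≤≐not-<ᵇ = Equivalence.to (≤⇔not-<ᵇ b _) , Equivalence.from (≤⇔not-<ᵇ b _)

Rows : List ℕ → ℕ → List Node
Rows λ′ n = concatMap (rimRow λ′) (asc n)

Rows-suc : (λ′ : List ℕ) (n : ℕ) → Rows λ′ (suc n) ≡ Rows λ′ n ++ rimRow λ′ (suc n)
Rows-suc λ′ n = trans (concatMap-++ (rimRow λ′) (asc n) [ suc n ]) (cong (Rows λ′ n ++_) (++-identityʳ _))

-- Consecutive rows join up: the last rim node (n + 1 , λ_{n+2}) of row n + 1 lies directly above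
-- the first rim node of row n + 2.
rows-path : {λ′ : List ℕ} → IsPartition λ′ → ∀ n → suc n ≤ len λ′ →
  Path (1 , part λ′ 1) (suc n , part λ′ (suc (suc n)) ⊔ 1) (Rows λ′ (suc n))
rows-path {λ′} ip zero 1≤ℓ = subst (Path _ _) (sym (Rows-suc λ′ 0)) (rimRow-path ip 0 1≤ℓ)
rows-path {λ′} ip (suc n) 2+n≤ℓ =
  subst (Path _ _) (sym (Rows-suc λ′ (suc n))) (path-++ previous down (rimRow-path ip (suc n) 2+n≤ℓ))
  where
  previous : Path (1 , part λ′ 1) (suc n , part λ′ (suc (suc n))) (Rows λ′ (suc n))
  previous = subst (λ c → Path (1 , part λ′ 1) (suc n , c) (Rows λ′ (suc n)))
                   (m≥n⇒m⊔n≡m (part-positive (proj₁ ip) (suc n) 2+n≤ℓ)) (rows-path ip n (<⇒≤ 2+n≤ℓ))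

RimLike : List Node → Set
RimLike rs = Linked Step rs × EndsBelow rs

-- The rim is such a chain: it ends at (ℓ , 1).
rim-rimLike : {λ′ : List ℕ} → IsPartition λ′ → RimLike (rim λ′)
rim-rimLike {[]}     _  = [] , nothing
rim-rimLike {x ∷ λ′} ip = path-chain p , subst (MaybeAll.All Below) (sym (path-last p)) (just last-below)
  where
  p = rows-path ip (len λ′) ≤-refl
  last-below : part λ′ (suc (len λ′)) ⊔ 1 ≤ suc (len λ′)
  last-below rewrite part-beyond λ′ = s≤s z≤n

rimLike-dropWhile : {Q : Pred Node 0ℓ} (Q? : Decidable Q) {rs : List Node} → RimLike rs → RimLike (dropWhile Q? rs)
rimLike-dropWhile Q? {rs} (chain , ends) = Linked-dropWhile Q? chain , last-dropWhile Q? rs ends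

-- The p-segments

module Segments (p ℓ : ℕ) where

  #above : List Node → ℕ
  #above xs = length (filter above? xs)

  #above-++ : ∀ xs ys → #above (xs ++ ys) ≡ #above xs + #above ys
  #above-++ xs ys = trans (cong length (filter-++ above? xs ys)) (length-++ (filter above? xs))

  -- A segment is the first p nodes of a rim-like path.  If it avoids the diagonal it lies on one
  -- side of it; if above, it cannot be the whole path, so it has exactly p nodes.
  segment-count : ∀ {rs seg} → take p rs ≡ seg → RimLike rs → All (¬_ ∘ Diagonal) seg → p ∣ #above seg
  segment-count {rs} refl (chain , ends) off with sign-constant (Linked-take p chain) off
  ... | inj₂ none-above = subst (p ∣_) (cong length (sym (filter-none above? none-above))) (p ∣0)
  ... | inj₁ all-above rewrite filter-all above? all-above with p ≤? length rs
  ...   | yes p≤∣rs∣ = subst (p ∣_) (sym (trans (length-take p rs) (m≤n⇒m⊓n≡m p≤∣rs∣))) ∣-refl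
  ...   | no p≰∣rs∣  = subst (λ xs → p ∣ length xs) (sym (trans whole empty)) (p ∣0)
    where
    whole : take p rs ≡ rs
    whole = take-all p rs (<⇒≤ (≰⇒> p≰∣rs∣))
    empty : rs ≡ []
    empty = strictly-above-empty ends (subst (All Above) whole all-above) (subst (All (¬_ ∘ Diagonal)) whole off)

  -- Rows weakly increase along a segment, so the next segment starts after the current one.
  skip-segment : ∀ {rs i j} → Linked Step rs → last (take p rs) ≡ just (i , j) →
    dropWhileᵇ (λ n → proj₁ n ≤ᵇ i) rs ≡ dropWhileᵇ (λ n → proj₁ n ≤ᵇ i) (drop p rs)
  skip-segment {rs} chain e = dropWhile-take _ p rs (All.map ≤⇒≤ᵇ (rows-≤-last (Linked-take p chain) e))

  -- The p-segments appear in order along the path, so their union is a sublist of it.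
  pSegs-⊆ : ∀ fuel {rs} → Linked Step rs → pSegs fuel p ℓ rs ⊆ rs
  pSegs-⊆ zero       {rs} _     = minimum rs
  pSegs-⊆ (suc fuel) {rs} chain with take p rs in e
  ... | seg with last seg in e′
  ...   | nothing      = subst (_⊆ rs) e (take-⊆ p rs)
  ...   | just (i , j) = subst₂ _⊆_ (cong (_++ _) e) (take++drop≡id p rs) (++⁺ ⊆-refl later)
    where
    Q = λ (n : Node) → proj₁ n ≤ᵇ i
    later : (if i <ᵇ ℓ then pSegs fuel p ℓ (dropWhileᵇ Q rs) else []) ⊆ drop p rs
    later with i <ᵇ ℓ
    ... | false = minimum _
    ... | true  = ⊆-trans (pSegs-⊆ fuel (Linked-dropWhile (T? ∘ Q) chain))
                    (subst (_⊆ drop p rs) (sym (skip-segment chain (trans (cong last e) e′)))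
                      (dropWhile-⊆ (T? ∘ Q) (drop p rs)))

  -- If the segments avoid the diagonal, each contributes 0 or p nodes above the diagonal.
  pSegs-count : ∀ fuel {rs} → RimLike rs → All (¬_ ∘ Diagonal) (pSegs fuel p ℓ rs) →
    p ∣ #above (pSegs fuel p ℓ rs)
  pSegs-count zero _ _ = p ∣0
  pSegs-count (suc fuel) {rs} rl off with take p rs in e
  ... | seg with last seg
  ...   | nothing      = segment-count e rl off
  ...   | just (i , _) with i <ᵇ ℓ
  ...     | false rewrite ++-identityʳ seg = segment-count e rl off
  ...     | true  rewrite #above-++ seg (pSegs fuel p ℓ (dropWhileᵇ (λ n → proj₁ n ≤ᵇ i) rs)) =
    ∣m∣n⇒∣m+n (segment-count e rl (All.++⁻ˡ seg off))
              (pSegs-count fuel (rimLike-dropWhile _ rl) (All.++⁻ʳ seg off))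

-- Counting a*

_≟ₙ_ : DecidableEquality Node
_≟ₙ_ = ≡-dec _≟_ _≟_

≡Nᵇ⇔≡ : ∀ {a b} → T (a ≡Nᵇ b) ⇔ a ≡ b
≡Nᵇ⇔≡ {i , j} {k , l} = mk⇔
  (λ t → let (i≡k , j≡l) = Equivalence.to T-∧ t in cong₂ _,_ (≡ᵇ⇒≡ i k i≡k) (≡ᵇ⇒≡ j l j≡l))
  (λ { refl → Equivalence.from T-∧ (≡⇒≡ᵇ i i refl , ≡⇒≡ᵇ j j refl) })

-- U_λ, as a filter with a decidable predicate.
upper : ℕ → List ℕ → List Node
upper p λ′ = filter above? (pRim p λ′)

aStar-≡ : ∀ p λ′ → aStar p λ′ ≡ length (deduplicate _≟ₙ_ (upper p λ′ ++ map swap (upper p λ′)))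
aStar-≡ p λ′ = cong length (begin
  deduplicateᵇ _≡Nᵇ_ (U p λ′ ++ L p λ′)                   ≡⟨ deduplicate-≐ _ _≟ₙ_ ≡Nᵇ⇔≡ _ ⟩
  deduplicate _≟ₙ_ (U p λ′ ++ map swap (U p λ′))         ≡⟨ cong (λ us → deduplicate _≟ₙ_ (us ++ map swap us)) U≡upper ⟩
  deduplicate _≟ₙ_ (upper p λ′ ++ map swap (upper p λ′)) ∎)
  where
  open ≡-Reasoning
  U≡upper : U p λ′ ≡ upper p λ′
  U≡upper = filter-≐ (T? ∘ λ n → proj₁ n ≤ᵇ proj₂ n) above? ((λ {n} → ≤ᵇ⇒≤ (proj₁ n) (proj₂ n)) , ≤⇒≤ᵇ) (pRim p λ′)

mirror-unique : ∀ {us vs} → Unique us → Unique vs → All Above us → All StrictlyAbove vs →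
  Unique (us ++ map swap vs)
mirror-unique uu uv above strictly-above =
  Unique.++⁺ uu (Unique.map⁺ (cong swap) uv)
    (disjoint {Q = StrictlyBelow} above (All.map⁺ strictly-above) (λ i≤j j<i → <⇒≱ j<i i≤j))

count-off-diagonal : ∀ {us} → Unique us → All StrictlyAbove us →
  length (deduplicate _≟ₙ_ (us ++ map swap us)) ≡ length us + length us
count-off-diagonal {us} u strictly-above = begin
  length (deduplicate _≟ₙ_ (us ++ map swap us))
    ≡⟨ cong length (deduplicate-unique _≟ₙ_ (mirror-unique u u (All.map <⇒≤ strictly-above) strictly-above)) ⟩
  length (us ++ map swap us)       ≡⟨ length-++ us ⟩
  length us + length (map swap us) ≡⟨ cong (length us +_) (length-map swap us) ⟩
  length us + length us            ∎
  where open ≡-Reasoning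

-- If U = U′ ++ [ d ] with d on the diagonal, d is its own mirror image and a* = 2 |U′| + 1.
count-diagonal : ∀ {us d} → Unique (us ++ [ d ]) → All StrictlyAbove us → Diagonal d →
  length (deduplicate _≟ₙ_ ((us ++ [ d ]) ++ map swap (us ++ [ d ]))) ≡ suc (length us + length us)
count-diagonal {us} {d} u strictly-above refl = begin
  length (deduplicate _≟ₙ_ ((us ++ [ d ]) ++ map swap (us ++ [ d ])))
    ≡⟨ cong (length ∘ deduplicate _≟ₙ_ ∘ ((us ++ [ d ]) ++_)) (map-++ swap us [ d ]) ⟩
  length (deduplicate _≟ₙ_ ((us ++ [ d ]) ++ (map swap us ++ [ d ])))
    ≡⟨ cong (length ∘ deduplicate _≟ₙ_) (sym (++-assoc (us ++ [ d ]) (map swap us) [ d ])) ⟩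
  length (deduplicate _≟ₙ_ (((us ++ [ d ]) ++ map swap us) ++ [ d ]))
    ≡⟨ cong length (deduplicate-++-∈ _≟ₙ_ (mirror-unique u u′ above strictly-above) d∈) ⟩
  length ((us ++ [ d ]) ++ map swap us)
    ≡⟨ cong length (++-assoc us [ d ] (map swap us)) ⟩
  length (us ++ d ∷ map swap us)
    ≡⟨ length-++ us ⟩
  length us + suc (length (map swap us))
    ≡⟨ cong (λ n → length us + suc n) (length-map swap us) ⟩
  length us + suc (length us)
    ≡⟨ +-suc (length us) (length us) ⟩
  suc (length us + length us) ∎
  where
  open ≡-Reasoning
  u′ : Unique us
  u′ = AllPairs-⊆ (++⁺ʳ [ d ] ⊆-refl) u
  above : All Above (us ++ [ d ])
  above = All.++⁺ (All.map <⇒≤ strictly-above) (≤-refl ∷ [])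
  d∈ : d ∈ (us ++ [ d ]) ++ map swap us
  d∈ = ∈-++⁺ˡ (∈-++⁺ʳ us (here refl))

not-even : ∀ k → ¬ 2 ∣ suc (k + k)
not-even k 2∣2k+1 = contradiction (∣1⇒≡1 (∣m+n∣m⇒∣n (subst (2 ∣_) (+-comm 1 (k + k)) 2∣2k+1) 2∣2k)) λ ()
  where
  2∣2k : 2 ∣ k + k
  2∣2k = divides k (trans (cong (k +_) (sym (+-identityʳ k))) (*-comm 2 k))

module _ (p : ℕ) {λ′ : List ℕ} (ip : IsPartition λ′) where
  open Segments p (len λ′)

  -- Rim_p is a sublist of the rim, so content strictly decreases along U_λ.
  upper-ordered : AllPairs _▷_ (upper p λ′)
  upper-ordered =
    AllPairs-⊆ (⊆-trans (filter-⊆ above? (pRim p λ′)) (pSegs-⊆ (suc (len λ′)) (proj₁ (rim-rimLike ip))))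
               (chain-ordered (proj₁ (rim-rimLike ip)))

  aStar-off-diagonal : All (¬_ ∘ Diagonal) (pRim p λ′) → p ∣ aStar p λ′
  aStar-off-diagonal off =
    subst (p ∣_) (sym (trans (aStar-≡ p λ′) (count-off-diagonal (AllPairs.map ▷⇒≢ upper-ordered) strictly-above)))
          (∣m∣n⇒∣m+n p∣U p∣U)
    where
    p∣U = pSegs-count (suc (len λ′)) (rim-rimLike ip) off
    strictly-above : All StrictlyAbove (upper p λ′)
    strictly-above = All.zipWith (uncurry ≤∧≢⇒<)
      (All.all-filter above? (pRim p λ′) , All-resp-⊆ (filter-⊆ above? (pRim p λ′)) off)

  aStar-diagonal : Any Diagonal (pRim p λ′) → ∃ λ k → aStar p λ′ ≡ suc (k + k)
  aStar-diagonal on-diagonal with find on-diagonal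
  ... | d , d∈ , diag
    with diagonal-last upper-ordered (All.all-filter above? (pRim p λ′)) (∈-filter⁺ above? d∈ (≤-reflexive diag)) diag
  ... | us , upper≡ = length us , (begin
    aStar p λ′                                                           ≡⟨ aStar-≡ p λ′ ⟩
    length (deduplicate _≟ₙ_ (upper p λ′ ++ map swap (upper p λ′)))      ≡⟨ cong (λ vs → length (deduplicate _≟ₙ_ (vs ++ map swap vs))) upper≡ ⟩
    length (deduplicate _≟ₙ_ ((us ++ [ d ]) ++ map swap (us ++ [ d ]))) ≡⟨ count-diagonal (AllPairs.map ▷⇒≢ ordered) strictly-above diag ⟩
    suc (length us + length us)                                          ∎)
    where
    open ≡-Reasoning
    ordered = subst (AllPairs _▷_) upper≡ upper-ordered
    strictly-above : All StrictlyAbove us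
    strictly-above = All.zipWith (λ (above , x▷d) → before-diagonal above x▷d diag)
      (All.++⁻ˡ us (subst (All Above) upper≡ (All.all-filter above? (pRim p λ′))) , AllPairs-last ordered)

lemma3p10 : (p : ℕ) → Prime p → ¬ (2 ∣ p) →
    (λ′ : List ℕ) → IsPartition λ′ → SelfConjugate λ′ →
    2 ∣ aStar p λ′ → p ∣ aStar p λ′
lemma3p10 p _ _ λ′ ip _ 2∣a* with any? diagonal? (pRim p λ′)
... | no off-diagonal = aStar-off-diagonal p ip (All.¬Any⇒All¬ (pRim p λ′) off-diagonal)
... | yes on-diagonal with aStar-diagonal p ip on-diagonal
...   | k , a*≡2k+1 = ⊥-elim (not-even k (subst (2 ∣_) a*≡2k+1 2∣a*))
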